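{- Let $n \ge k \ge r \ge 2$ be integers and let $\mathcal{H}$ be a $k$-colorable $r$-graph on $n$ vertices without isolated vertices satisfying \[ \delta_{r-1}^{+}(\mathcal{H}) > \max\left\{\frac{3k-3r+1}{3k-2}\, n,\ \frac{k-r+1}{k+2}\, n\right\}. \] Then for every $\varphi\in\mathrm{Hom}(\mathcal{H},K_k^r)$: (i) $|\varphi^{ -1}(J)| \ge \frac{|J|}{k-r+1}\cdot \delta_{r-1}^{+}(\mathcal{H})$ for every set $J\subseteq[k]$ with $|J|\ge k-r+1$; (ii) $\varphi$ is surjective; (iii) $|J_\varphi| \le r-2$, where $J_\varphi = \{j\in[k] : |\varphi^{ -1}(j)| \ge \frac{3n}{3k-2}\}$.
   Context: An $r$-graph $\mathcal{H}$ is a collection of $r$-element subsets (edges) of a finite vertex set $V(\mathcal{H})$; a vertex is isolated if it lies in no edge. $\partial\mathcal{H}$ is the set of $(r-1)$-sets contained in some edge; for an $(r-1)$-set $S$, $d_{\mathcal{H}}(S)$ is the number of vertices $v$ with $S\cup\{v\}\in\mathcal{H}$, and $\delta^{+}_{r-1}(\mathcal{H})=\min\{d_{\mathcal{H}}(S): S\in\partial\mathcal{H}\}$. $\mathrm{Hom}(\mathcal{H},K_k^r)$ is the set of maps $\varphi:V(\mathcal{H})\to[k]$ that are injective on every edge; $\mathcal{H}$ is $k$-colorable if this set is nonempty. For $J\subseteq[k]$, $\varphi^{ -1}(J)=\{v : \varphi(v)\in J\}$. -}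

module Defs where

open import Data.Nat using (ℕ; _+_; _*_; _∸_; _≤_; _<_)
open import Data.Bool using (Bool; true; false; not; _∧_)
open import Data.Fin using (Fin)
open import Data.Fin.Subset using (Subset; _∈_; _⊆_; _∪_; ⁅_⁆; ∣_∣)
open import Data.Vec using (lookup; tabulate)
open import Data.Product using (Σ; _×_)
open import Relation.Binary.PropositionalEquality using (_≡_)

record Hypergraph (n r : ℕ) : Set where
  field
    edge    : Subset n → Bool
    uniform : ∀ e → edge e ≡ true → ∣ e ∣ ≡ r
open Hypergraph public

IsEdge : ∀ {n r} → Hypergraph n r → Subset n → Set
IsEdge H e = edge H e ≡ true

NoIsolated : ∀ {n r} → Hypergraph n r → Set
NoIsolated {n} H = ∀ (v : Fin n) → Σ (Subset n) λ e → IsEdge H e × v ∈ e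

InShadow : ∀ {n r} → Hypergraph n r → Subset n → Set
InShadow {n} {r} H S = ∣ S ∣ ≡ r ∸ 1 × Σ (Subset n) λ e → IsEdge H e × S ⊆ e

-- the set of vertices v with S ∪ {v} ∈ H (v ∉ S, automatic for (r-1)-sets S)
nbhd : ∀ {n r} → Hypergraph n r → Subset n → Subset n
nbhd H S = tabulate λ v → not (lookup S v) ∧ edge H (S ∪ ⁅ v ⁆)

codeg : ∀ {n r} → Hypergraph n r → Subset n → ℕ
codeg H S = ∣ nbhd H S ∣

IsMinPosCodeg : ∀ {n r} → Hypergraph n r → ℕ → Set
IsMinPosCodeg {n} H δ =
  (∀ S → InShadow H S → δ ≤ codeg H S) ×
  Σ (Subset n) λ S → InShadow H S × codeg H S ≡ δ

-- φ ∈ Hom(H, K_k^r): injective on every edge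
IsHom : ∀ {n r k} → Hypergraph n r → (Fin n → Fin k) → Set
IsHom {n} H φ = ∀ e → IsEdge H e → ∀ (u v : Fin n) → u ∈ e → v ∈ e → φ u ≡ φ v → u ≡ v

Colorable : ∀ {n r} → Hypergraph n r → ℕ → Set
Colorable {n} H k = Σ (Fin n → Fin k) λ φ → IsHom H φ

preimage : ∀ {n k} → (Fin n → Fin k) → Subset k → Subset n
preimage φ J = tabulate λ v → lookup J (φ v)

-- J_φ = { j : |φ⁻¹(j)| ≥ 3n/(3k-2) }, written as |φ⁻¹(j)|·(3k-2) ≥ 3n
-- (valid since 3k-2 > 0 for k ≥ 2); decided via Data.Nat._≤ᵇ_
open import Data.Nat using (_≤ᵇ_)
bigClasses : ∀ {n k} → (Fin n → Fin k) → Subset k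
bigClasses {n} {k} φ = tabulate λ j → (3 * n) ≤ᵇ (∣ preimage φ ⁅ j ⁆ ∣ * (3 * k ∸ 2))

-- Fix a set T of k - r + 1 colours. Starting from any S ∈ ∂H, as long as S has a
-- neighbour v coloured outside T, the edge S ∪ {v} carries r distinct colours, so
-- it meets φ⁻¹(T) in some u ∈ S; swapping u for v gives a shadow set with fewer
-- vertices in φ⁻¹(T). Once this stops, N(S) ⊆ φ⁻¹(T) and so |φ⁻¹(T)| ≥ δ.
-- Averaging this over the (k - r + 1)-subsets of J gives (i). A missing colour
-- could be added to every (k - r)-set of colours for free; averaging over the
-- other k - 1 colours then gives δ ≤ (k - r) n / (k - 1), contradicting the
-- codegree bound, which is (ii). For (iii), r - 1 classes of size ≥ 3n/(3k - 2)
-- plus the remaining k - r + 1 classes (of total size ≥ δ) would exceed n.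

module Submission where

open import Defs
open import Data.Nat using (ℕ; zero; suc; _+_; _*_; _∸_; _≤_; _<_; z≤n; s≤s)
open import Data.Nat.Properties
open import Data.Nat.Tactic.RingSolver using (solve-∀)
open import Data.Bool using (true; false; not; _∧_; T)
open import Data.Unit using (tt)
open import Data.Fin using (Fin; zero; suc)
open import Data.Fin.Properties using (any?) renaming (_≟_ to _≟ᶠ_)
import Data.Fin.Properties as Fin
open import Data.Fin.Subset hiding (⊥)
open import Data.Fin.Subset using () renaming (⊥ to ∅)
open import Data.Fin.Subset.Properties
open import Data.Vec using ([]; _∷_; here; there; lookup)
open import Data.Vec.Properties using (lookup-replicate; lookup∘tabulate; []=⇒lookup; lookup⇒[]=)
open import Data.Product using (Σ; ∃-syntax; _×_; _,_; proj₁)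
open import Data.Sum using (inj₁; inj₂)
open import Data.Empty using (⊥-elim)
open import Relation.Nullary using (yes; no; ¬_)
open import Relation.Nullary.Decidable using (_×-dec_; ¬?)
open import Induction.WellFounded using (Acc; acc)
open import Data.Nat.Induction using (<-wellFounded)
open import Function using (const)
open import Relation.Binary.PropositionalEquality
open import Algebra.Properties.CommutativeSemigroup +-commutativeSemigroup using (interchange; x∙yz≈y∙xz)

private variable
  k n : ℕ

x∈p─q⇒x∉q : ∀ (p q : Subset k) {x} → x ∈ p ─ q → x ∉ q
x∈p─q⇒x∉q (_ ∷ p) (inside  ∷ q) (there x∈p─q) (there x∈q) = x∈p─q⇒x∉q p q x∈p─q x∈q
x∈p─q⇒x∉q (_ ∷ p) (outside ∷ q) (there x∈p─q) (there x∈q) = x∈p─q⇒x∉q p q x∈p─q x∈q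

x∉p⇒[p∪⁅x⁆]-x≡p : ∀ {p : Subset k} {x} → x ∉ p → (p ∪ ⁅ x ⁆) - x ≡ p
x∉p⇒[p∪⁅x⁆]-x≡p {p = p} {x} x∉p = ⊆-antisym ⊆p p⊆
  where
  ⊆p : (p ∪ ⁅ x ⁆) - x ⊆ p
  ⊆p y∈ with x∈p∪q⁻ p ⁅ x ⁆ (p─q⊆p _ ⁅ x ⁆ y∈)
  ... | inj₁ y∈p   = y∈p
  ... | inj₂ y∈⁅x⁆ = ⊥-elim (x∈p─q⇒x∉q (p ∪ ⁅ x ⁆) ⁅ x ⁆ y∈ y∈⁅x⁆)
  p⊆ : p ⊆ (p ∪ ⁅ x ⁆) - x
  p⊆ y∈p = x∈p∧x≢y⇒x∈p-y (x∈p∪q⁺ (inj₁ y∈p)) (λ { refl → x∉p y∈p })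

∣p∣≡1+m⇒Nonempty : ∀ {J : Subset k} {m} → ∣ J ∣ ≡ suc m → Nonempty J
∣p∣≡1+m⇒Nonempty {k} {J} ∣J∣≡1+m with nonempty? J
... | yes J≢∅ = J≢∅
... | no  J≡∅ = ⊥-elim (1+n≢0 (trans (sym ∣J∣≡1+m) (trans (cong ∣_∣ (Empty-unique J≡∅)) (∣⊥∣≡0 k))))

∃-⊆-of-size : ∀ (J : Subset k) {m} → m ≤ ∣ J ∣ → ∃[ T ] T ⊆ J × ∣ T ∣ ≡ m
∃-⊆-of-size {k} J {zero} _ = ∅ , ⊥⊆ , ∣⊥∣≡0 k
∃-⊆-of-size (inside ∷ J) {suc m} (s≤s m≤∣J∣) with ∃-⊆-of-size J m≤∣J∣
... | T , T⊆J , ∣T∣≡m = inside ∷ T , in⊆in T⊆J , cong suc ∣T∣≡m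
∃-⊆-of-size (outside ∷ J) {suc m} m≤∣J∣ with ∃-⊆-of-size J m≤∣J∣
... | T , T⊆J , ∣T∣≡m = outside ∷ T , out⊆ T⊆J , ∣T∣≡m

∃-max : ∀ (w : Fin k → ℕ) (J : Subset k) → Nonempty J →
        ∃[ j ] j ∈ J × (∀ {i} → i ∈ J → w i ≤ w j)
∃-max w (s ∷ J) _ with nonempty? J
∃-max w (s ∷ J) _ | yes J≢∅ with ∃-max (λ i → w (suc i)) J J≢∅
∃-max w (outside ∷ J) _ | yes _ | j , j∈J , max = suc j , there j∈J , λ { (there i∈J) → max i∈J }
∃-max w (inside  ∷ J) _ | yes _ | j , j∈J , max with w zero ≤? w (suc j)
... | yes w₀≤ = suc j , there j∈J , λ { here → w₀≤ ; (there i∈J) → max i∈J }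
... | no  w₀≰ = zero , here , λ { here → ≤-refl ; (there i∈J) → ≤-trans (max i∈J) (<⇒≤ (≰⇒> w₀≰)) }
∃-max w (inside  ∷ J) _ | no J≡∅ = zero , here , λ { here → ≤-refl ; (there i∈J) → ⊥-elim (J≡∅ (_ , i∈J)) }
∃-max w (outside ∷ J) (suc i , there i∈J) | no J≡∅ = ⊥-elim (J≡∅ (i , i∈J))

∑ : Subset k → (Fin k → ℕ) → ℕ
∑ []             w = 0
∑ (inside  ∷ J) w = w zero + ∑ J (λ j → w (suc j))
∑ (outside ∷ J) w = ∑ J (λ j → w (suc j))

∑-cong : ∀ (J : Subset k) {f g : Fin k → ℕ} → (∀ j → f j ≡ g j) → ∑ J f ≡ ∑ J g
∑-cong []             f≗g = refl
∑-cong (inside  ∷ J) f≗g = cong₂ _+_ (f≗g zero) (∑-cong J (λ j → f≗g (suc j)))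
∑-cong (outside ∷ J) f≗g = ∑-cong J (λ j → f≗g (suc j))

∑-mono : ∀ (J : Subset k) {f g : Fin k → ℕ} → (∀ {j} → j ∈ J → f j ≤ g j) → ∑ J f ≤ ∑ J g
∑-mono []             f≤g = z≤n
∑-mono (inside  ∷ J) f≤g = +-mono-≤ (f≤g here) (∑-mono J (λ j∈J → f≤g (there j∈J)))
∑-mono (outside ∷ J) f≤g = ∑-mono J (λ j∈J → f≤g (there j∈J))

∑-+ : ∀ (J : Subset k) (f g : Fin k → ℕ) → ∑ J (λ j → f j + g j) ≡ ∑ J f + ∑ J g
∑-+ []             f g = refl
∑-+ (inside  ∷ J) f g = trans (cong (f zero + g zero +_) (∑-+ J _ _)) (interchange (f zero) _ _ _)
∑-+ (outside ∷ J) f g = ∑-+ J _ _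

∑-const : ∀ (J : Subset k) c → ∑ J (const c) ≡ ∣ J ∣ * c
∑-const []             c = refl
∑-const (inside  ∷ J) c = cong (c +_) (∑-const J c)
∑-const (outside ∷ J) c = ∑-const J c

∑-*ʳ : ∀ (J : Subset k) (f : Fin k → ℕ) d → ∑ J (λ j → f j * d) ≡ ∑ J f * d
∑-*ʳ []             f d = refl
∑-*ʳ (inside  ∷ J) f d = trans (cong (f zero * d +_) (∑-*ʳ J _ d)) (sym (*-distribʳ-+ d (f zero) _))
∑-*ʳ (outside ∷ J) f d = ∑-*ʳ J _ d

∑-remove : ∀ {J : Subset k} {j} (w : Fin k → ℕ) → j ∈ J → ∑ J w ≡ w j + ∑ (J - j) w
∑-remove {J = inside ∷ J} w here = cong (w zero +_) (cong (λ J′ → ∑ J′ _) (sym (p─⊥≡p J)))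
∑-remove {J = inside ∷ J} {suc j} w (there j∈J) =
  trans (cong (w zero +_) (∑-remove _ j∈J)) (x∙yz≈y∙xz (w zero) (w (suc j)) _)
∑-remove {J = outside ∷ J} w (there j∈J) = ∑-remove _ j∈J

∑-∁ : ∀ (J : Subset k) (w : Fin k → ℕ) → ∑ J w + ∑ (∁ J) w ≡ ∑ ⊤ w
∑-∁ []             w = refl
∑-∁ (inside  ∷ J) w = trans (+-assoc (w zero) _ _) (cong (w zero +_) (∑-∁ J _))
∑-∁ (outside ∷ J) w = trans (x∙yz≈y∙xz (∑ J (λ i → w (suc i))) (w zero) _) (cong (w zero +_) (∑-∁ J _))

∣p∣≡∑1 : ∀ (J : Subset k) → ∣ J ∣ ≡ ∑ J (const 1)
∣p∣≡∑1 J = sym (trans (∑-const J 1) (*-identityʳ _))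

x∈p⇒∣p∣≡1+∣p-x∣ : ∀ {J : Subset k} {j} → j ∈ J → ∣ J ∣ ≡ suc ∣ J - j ∣
x∈p⇒∣p∣≡1+∣p-x∣ {J = J} {j} j∈J = begin
  ∣ J ∣                    ≡⟨ ∣p∣≡∑1 J ⟩
  ∑ J (const 1)           ≡⟨ ∑-remove _ j∈J ⟩
  1 + ∑ (J - j) (const 1) ≡⟨ cong suc (∣p∣≡∑1 (J - j)) ⟨
  suc ∣ J - j ∣ ∎
  where open ≡-Reasoning

-- For a heaviest j ∈ J, any q-subset of J - j shows δ ≤ q · w j, so j can be
-- split off and the rest handled by induction.
∑-averaging : ∀ (w : Fin k → ℕ) {q δ} (J : Subset k) → q ≤ ∣ J ∣ →
              (∀ {T} → T ⊆ J → ∣ T ∣ ≡ q → δ ≤ ∑ T w) → ∣ J ∣ * δ ≤ ∑ J w * q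
∑-averaging w {q} {δ} J q≤∣J∣ heavy = go (∣ J ∣ ∸ q) J (sym (m∸n+n≡m q≤∣J∣)) heavy
  where
  go : ∀ d J → ∣ J ∣ ≡ d + q → (∀ {T} → T ⊆ J → ∣ T ∣ ≡ q → δ ≤ ∑ T w) → ∣ J ∣ * δ ≤ ∑ J w * q
  go zero J ∣J∣≡q heavy = begin
    ∣ J ∣ * δ ≡⟨ cong (_* δ) ∣J∣≡q ⟩
    q * δ     ≤⟨ *-monoʳ-≤ q (heavy ⊆-refl ∣J∣≡q) ⟩
    q * ∑ J w ≡⟨ *-comm q _ ⟩
    ∑ J w * q ∎
    where open ≤-Reasoning
  go (suc d) J ∣J∣≡ heavy with ∃-max w J (∣p∣≡1+m⇒Nonempty ∣J∣≡)
  ... | j , j∈J , max = begin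
    ∣ J ∣ * δ                 ≡⟨ cong (_* δ) (x∈p⇒∣p∣≡1+∣p-x∣ j∈J) ⟩
    δ + ∣ J - j ∣ * δ          ≤⟨ +-mono-≤ δ≤wⱼq (go d (J - j) ∣J-j∣≡ (λ T⊆ → heavy (⊆-trans T⊆ J-j⊆J))) ⟩
    w j * q + ∑ (J - j) w * q ≡⟨ *-distribʳ-+ q (w j) _ ⟨
    (w j + ∑ (J - j) w) * q   ≡⟨ cong (_* q) (∑-remove w j∈J) ⟨
    ∑ J w * q ∎
    where
    open ≤-Reasoning
    J-j⊆J : J - j ⊆ J
    J-j⊆J = p─q⊆p J ⁅ j ⁆
    ∣J-j∣≡ : ∣ J - j ∣ ≡ d + q
    ∣J-j∣≡ = suc-injective (trans (sym (x∈p⇒∣p∣≡1+∣p-x∣ j∈J)) ∣J∣≡)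
    δ≤wⱼq : δ ≤ w j * q
    δ≤wⱼq with ∃-⊆-of-size (J - j) (≤-trans (m≤n+m q d) (≤-reflexive (sym ∣J-j∣≡)))
    ... | T , T⊆J-j , ∣T∣≡q = begin
      δ                 ≤⟨ heavy (⊆-trans T⊆J-j J-j⊆J) ∣T∣≡q ⟩
      ∑ T w             ≤⟨ ∑-mono T (λ i∈T → max (J-j⊆J (T⊆J-j i∈T))) ⟩
      ∑ T (const (w j)) ≡⟨ ∑-const T (w j) ⟩
      ∣ T ∣ * w j       ≡⟨ cong (_* w j) ∣T∣≡q ⟩
      q * w j           ≡⟨ *-comm q _ ⟩
      w j * q ∎

∈-preimage⁺ : ∀ {φ : Fin n → Fin k} {J v} → φ v ∈ J → v ∈ preimage φ J
∈-preimage⁺ {φ = φ} {J} {v} φv∈J =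
  lookup⇒[]= v _ (trans (lookup∘tabulate (λ u → lookup J (φ u)) v) ([]=⇒lookup φv∈J))

∈-preimage⁻ : ∀ {φ : Fin n → Fin k} {J v} → v ∈ preimage φ J → φ v ∈ J
∈-preimage⁻ {φ = φ} {J} {v} v∈φ⁻¹J =
  lookup⇒[]= (φ v) J (trans (sym (lookup∘tabulate (λ u → lookup J (φ u)) v)) ([]=⇒lookup v∈φ⁻¹J))

preimage-⊤ : ∀ (φ : Fin n → Fin k) → preimage φ ⊤ ≡ ⊤
preimage-⊤ φ = ⊆-antisym ⊆⊤ (λ _ → ∈-preimage⁺ {φ = φ} ∈⊤)

classSize : (Fin n → Fin k) → Fin k → ℕ
classSize φ j = ∣ preimage φ ⁅ j ⁆ ∣

indicator : Side → ℕ
indicator inside  = 1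
indicator outside = 0

∣s∷p∣ : ∀ s (p : Subset k) → ∣ s ∷ p ∣ ≡ indicator s + ∣ p ∣
∣s∷p∣ inside  p = refl
∣s∷p∣ outside p = refl

∑-zero : ∀ (J : Subset k) → ∑ J (const 0) ≡ 0
∑-zero J = trans (∑-const J 0) (*-zeroʳ ∣ J ∣)

∑-indicator : ∀ (J : Subset k) x → ∑ J (λ j → indicator (lookup ⁅ j ⁆ x)) ≡ indicator (lookup J x)
∑-indicator (inside  ∷ J) zero    = cong suc (∑-zero J)
∑-indicator (outside ∷ J) zero    = ∑-zero J
∑-indicator (inside  ∷ J) (suc x) =
  trans (cong (λ s → indicator s + ∑ J (λ j → indicator (lookup ⁅ j ⁆ x))) (lookup-replicate x outside)) (∑-indicator J x)
∑-indicator (outside ∷ J) (suc x) = ∑-indicator J x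

∣preimage∣≡∑classSize : ∀ (φ : Fin n → Fin k) J → ∣ preimage φ J ∣ ≡ ∑ J (classSize φ)
∣preimage∣≡∑classSize {zero}  φ J = sym (∑-zero J)
∣preimage∣≡∑classSize {suc n} φ J = begin
  ∣ lookup J (φ zero) ∷ preimage φ′ J ∣                             ≡⟨ ∣s∷p∣ _ (preimage φ′ J) ⟩
  indicator (lookup J (φ zero)) + ∣ preimage φ′ J ∣                 ≡⟨ cong₂ _+_ (sym (∑-indicator J (φ zero))) (∣preimage∣≡∑classSize φ′ J) ⟩
  ∑ J (λ j → indicator (lookup ⁅ j ⁆ (φ zero))) + ∑ J (classSize φ′) ≡⟨ ∑-+ J _ _ ⟨
  ∑ J (λ j → indicator (lookup ⁅ j ⁆ (φ zero)) + classSize φ′ j)     ≡⟨ ∑-cong J (λ j → ∣s∷p∣ _ (preimage φ′ ⁅ j ⁆)) ⟨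
  ∑ J (classSize φ) ∎
  where
  open ≡-Reasoning
  φ′ : Fin n → Fin _
  φ′ v = φ (suc v)

∑classSize-⊤ : ∀ (φ : Fin n → Fin k) → ∑ ⊤ (classSize φ) ≡ n
∑classSize-⊤ {n} φ = trans (sym (∣preimage∣≡∑classSize φ ⊤)) (trans (cong ∣_∣ (preimage-⊤ φ)) (∣⊤∣≡n n))

preimage-∁ : ∀ (φ : Fin n → Fin k) A → ∣ preimage φ A ∣ + ∣ preimage φ (∁ A) ∣ ≡ n
preimage-∁ φ A = begin
  ∣ preimage φ A ∣ + ∣ preimage φ (∁ A) ∣       ≡⟨ cong₂ _+_ (∣preimage∣≡∑classSize φ A) (∣preimage∣≡∑classSize φ (∁ A)) ⟩
  ∑ A (classSize φ) + ∑ (∁ A) (classSize φ) ≡⟨ ∑-∁ A (classSize φ) ⟩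
  ∑ ⊤ (classSize φ)                           ≡⟨ ∑classSize-⊤ φ ⟩
  _ ∎
  where open ≡-Reasoning

classwise-lower-bound : ∀ (φ : Fin n → Fin k) A {c d} → (∀ {j} → j ∈ A → c ≤ classSize φ j * d) →
                        ∣ A ∣ * c ≤ ∣ preimage φ A ∣ * d
classwise-lower-bound φ A {c} {d} bound = begin
  ∣ A ∣ * c                       ≡⟨ ∑-const A c ⟨
  ∑ A (const c)                   ≤⟨ ∑-mono A bound ⟩
  ∑ A (λ j → classSize φ j * d)  ≡⟨ ∑-*ʳ A (classSize φ) d ⟩
  ∑ A (classSize φ) * d           ≡⟨ cong (_* d) (∣preimage∣≡∑classSize φ A) ⟨
  ∣ preimage φ A ∣ * d ∎
  where open ≤-Reasoning

InjectiveOn : (Fin n → Fin k) → Subset n → Set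
InjectiveOn φ e = ∀ u v → u ∈ e → v ∈ e → φ u ≡ φ v → u ≡ v

injectiveOn⇒∣e∣≤∣C∣ : ∀ (φ : Fin n → Fin k) e {C} → InjectiveOn φ e →
                      (∀ {u} → u ∈ e → φ u ∈ C) → ∣ e ∣ ≤ ∣ C ∣
injectiveOn⇒∣e∣≤∣C∣ φ [] inj maps = z≤n
injectiveOn⇒∣e∣≤∣C∣ φ (outside ∷ e) inj maps =
  injectiveOn⇒∣e∣≤∣C∣ (λ u → φ (suc u)) e
    (λ u v u∈e v∈e eq → Fin.suc-injective (inj _ _ (there u∈e) (there v∈e) eq)) (λ u∈e → maps (there u∈e))
injectiveOn⇒∣e∣≤∣C∣ φ (inside ∷ e) {C} inj maps = begin
  suc ∣ e ∣           ≤⟨ s≤s (injectiveOn⇒∣e∣≤∣C∣ (λ u → φ (suc u)) e inj′ maps′) ⟩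
  suc ∣ C - φ zero ∣ ≡⟨ x∈p⇒∣p∣≡1+∣p-x∣ (maps here) ⟨
  ∣ C ∣ ∎
  where
  open ≤-Reasoning
  inj′ : InjectiveOn (λ u → φ (suc u)) e
  inj′ u v u∈e v∈e eq = Fin.suc-injective (inj _ _ (there u∈e) (there v∈e) eq)
  maps′ : ∀ {u} → u ∈ e → φ (suc u) ∈ C - φ zero
  maps′ u∈e = x∈p∧x≢y⇒x∈p-y (maps (there u∈e)) (λ eq → Fin.0≢1+n (sym (inj _ _ (there u∈e) here eq)))

injectiveOn-meets : ∀ (φ : Fin n → Fin k) {e} T → InjectiveOn φ e → k < ∣ e ∣ + ∣ T ∣ →
                    ∃[ u ] u ∈ e × φ u ∈ T
injectiveOn-meets {k = k} φ {e} T inj k<∣e∣+∣T∣ with any? (λ u → u ∈? e ×-dec φ u ∈? T)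
... | yes found = found
... | no  none  = ⊥-elim (<⇒≱ k<∣e∣+∣T∣ (begin
  ∣ e ∣ + ∣ T ∣     ≤⟨ +-monoˡ-≤ ∣ T ∣ (injectiveOn⇒∣e∣≤∣C∣ φ e inj maps) ⟩
  ∣ ∁ T ∣ + ∣ T ∣   ≡⟨ cong (_+ ∣ T ∣) (∣∁p∣≡n∸∣p∣ T) ⟩
  k ∸ ∣ T ∣ + ∣ T ∣ ≡⟨ m∸n+n≡m (∣p∣≤n T) ⟩
  k                 ∎))
  where
  open ≤-Reasoning
  maps : ∀ {u} → u ∈ e → φ u ∈ ∁ T
  maps u∈e = x∉p⇒x∈∁p (λ φu∈T → none (_ , u∈e , φu∈T))

-- The exchange argument

∈-nbhd⇒IsEdge : ∀ {r} (H : Hypergraph n r) {S v} → v ∈ nbhd H S → IsEdge H (S ∪ ⁅ v ⁆)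
∈-nbhd⇒IsEdge H {S} {v} v∈N = right-conjunct (trans (sym (lookup∘tabulate _ v)) ([]=⇒lookup v∈N))
  where
  right-conjunct : ∀ {a b} → not a ∧ b ≡ true → b ≡ true
  right-conjunct {false} b≡true = b≡true

module _ {r} (H : Hypergraph n r) {φ : Fin n → Fin k} (hom : IsHom H φ)
         (T : Subset k) (k<r+∣T∣ : k < r + ∣ T ∣) where

  swap-into-colours : ∀ {S v u} → IsEdge H (S ∪ ⁅ v ⁆) → v ∉ preimage φ T →
                      u ∈ S ∪ ⁅ v ⁆ → u ∈ preimage φ T →
                      InShadow H ((S ∪ ⁅ v ⁆) - u) ×
                      ∣ ((S ∪ ⁅ v ⁆) - u) ∩ preimage φ T ∣ < ∣ S ∩ preimage φ T ∣
  swap-into-colours {S} {v} {u} e∈H v∉P u∈e u∈P =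
    S′∈∂H , p⊂q⇒∣p∣<∣q∣ (S′∩P⊆S∩P , u , x∈p∩q⁺ (∈S u∈e u∈P , u∈P) , u∉S′∩P)
    where
    e = S ∪ ⁅ v ⁆
    ∈S : ∀ {x} → x ∈ e → x ∈ preimage φ T → x ∈ S
    ∈S {x} x∈e x∈P with x∈p∪q⁻ S ⁅ v ⁆ x∈e
    ... | inj₁ x∈S  = x∈S
    ... | inj₂ x∈⁅v⁆ = ⊥-elim (v∉P (subst (_∈ preimage φ T) (x∈⁅y⁆⇒x≡y v x∈⁅v⁆) x∈P))
    S′∈∂H : InShadow H (e - u)
    S′∈∂H = cong (_∸ 1) (trans (sym (x∈p⇒∣p∣≡1+∣p-x∣ u∈e)) (uniform H e e∈H)) , e , e∈H , p─q⊆p e ⁅ u ⁆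
    S′∩P⊆S∩P : (e - u) ∩ preimage φ T ⊆ S ∩ preimage φ T
    S′∩P⊆S∩P x∈S′∩P with x∈p∩q⁻ (e - u) _ x∈S′∩P
    ... | x∈e-u , x∈P = x∈p∩q⁺ (∈S (p─q⊆p e ⁅ u ⁆ x∈e-u) x∈P , x∈P)
    u∉S′∩P : u ∉ (e - u) ∩ preimage φ T
    u∉S′∩P u∈S′∩P = x∈p─q⇒x∉q e ⁅ u ⁆ (proj₁ (x∈p∩q⁻ (e - u) _ u∈S′∩P)) (x∈⁅x⁆ u)

  exchange : ∀ {S v} → v ∈ nbhd H S → v ∉ preimage φ T →
             ∃[ S′ ] InShadow H S′ × ∣ S′ ∩ preimage φ T ∣ < ∣ S ∩ preimage φ T ∣
  exchange v∈N v∉P =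
    let u , u∈e , φu∈T = injectiveOn-meets φ T (hom _ e∈H) k<∣e∣+∣T∣
    in  _ , swap-into-colours e∈H v∉P u∈e (∈-preimage⁺ {φ = φ} φu∈T)
    where
    e∈H = ∈-nbhd⇒IsEdge H v∈N
    k<∣e∣+∣T∣ = subst (λ m → k < m + ∣ T ∣) (sym (uniform H _ e∈H)) k<r+∣T∣

  ∃-closed-shadow-set : ∀ {S} → InShadow H S → ∃[ S′ ] InShadow H S′ × nbhd H S′ ⊆ preimage φ T
  ∃-closed-shadow-set S∈∂H = go S∈∂H (<-wellFounded _)
    where
    go : ∀ {S} → InShadow H S → Acc _<_ ∣ S ∩ preimage φ T ∣ →
         ∃[ S′ ] InShadow H S′ × nbhd H S′ ⊆ preimage φ T
    go {S} S∈∂H (acc smaller) with any? (λ v → v ∈? nbhd H S ×-dec ¬? (v ∈? preimage φ T))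
    ... | yes (v , v∈N , v∉P) with exchange v∈N v∉P
    ...   | S′ , S′∈∂H , fewer = go S′∈∂H (smaller fewer)
    go {S} S∈∂H _ | no none = S , S∈∂H , N⊆P
      where
      N⊆P : nbhd H S ⊆ preimage φ T
      N⊆P {v} v∈N with v ∈? preimage φ T
      ... | yes v∈P = v∈P
      ... | no  v∉P = ⊥-elim (none (v , v∈N , v∉P))

  minCodeg≤∣preimage∣ : ∀ {δ} → IsMinPosCodeg H δ → δ ≤ ∣ preimage φ T ∣
  minCodeg≤∣preimage∣ (δ≤codeg , _ , S∈∂H , _) with ∃-closed-shadow-set S∈∂H
  ... | S′ , S′∈∂H , N⊆P = ≤-trans (δ≤codeg _ S′∈∂H) (p⊆q⇒∣p∣≤∣q∣ N⊆P)

module _ (φ : Fin n → Fin k) {q δ} (heavy : ∀ T → ∣ T ∣ ≡ q → δ ≤ ∣ preimage φ T ∣) where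

  preimage-averaging : ∀ J → q ≤ ∣ J ∣ → ∣ J ∣ * δ ≤ ∣ preimage φ J ∣ * q
  preimage-averaging J q≤∣J∣ = subst (λ m → ∣ J ∣ * δ ≤ m * q) (sym (∣preimage∣≡∑classSize φ J))
    (∑-averaging (classSize φ) J q≤∣J∣ (λ {T} _ ∣T∣≡q → subst (δ ≤_) (∣preimage∣≡∑classSize φ T) (heavy T ∣T∣≡q)))

  missing-colour-bound : ∀ {p} → q ≡ suc p → q ≤ k → ∀ {j} → (∀ v → φ v ≢ j) → (k ∸ 1) * δ ≤ n * p
  missing-colour-bound {p} refl q≤k {j} missing = subst₂ (λ x y → x * δ ≤ y * p) ∣U∣≡k-1 ∑U≡n
    (∑-averaging w U (subst (p ≤_) (sym ∣U∣≡k-1) (∸-monoˡ-≤ 1 q≤k)) heavy-in-U)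
    where
    w = classSize φ
    U = ⊤ - j
    wⱼ≡0 : w j ≡ 0
    wⱼ≡0 = trans (cong ∣_∣ (Empty-unique λ (v , v∈) → missing v (x∈⁅y⁆⇒x≡y j (∈-preimage⁻ {φ = φ} v∈)))) (∣⊥∣≡0 n)
    ∣U∣≡k-1 : ∣ U ∣ ≡ k ∸ 1
    ∣U∣≡k-1 = cong (_∸ 1) (trans (sym (x∈p⇒∣p∣≡1+∣p-x∣ {J = ⊤ {k}} {j} ∈⊤)) (∣⊤∣≡n k))
    ∑U≡n : ∑ U w ≡ n
    ∑U≡n = trans (sym (cong (_+ ∑ U w) wⱼ≡0)) (trans (sym (∑-remove {J = ⊤} w ∈⊤)) (∑classSize-⊤ φ))
    heavy-in-U : ∀ {T} → T ⊆ U → ∣ T ∣ ≡ p → δ ≤ ∑ T w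
    heavy-in-U {T} T⊆U ∣T∣≡p = begin
      δ                              ≤⟨ heavy T⁺ ∣T⁺∣≡1+p ⟩
      ∣ preimage φ T⁺ ∣              ≡⟨ ∣preimage∣≡∑classSize φ T⁺ ⟩
      ∑ T⁺ w                         ≡⟨ ∑-remove w j∈T⁺ ⟩
      w j + ∑ (T⁺ - j) w             ≡⟨ cong₂ (λ x S → x + ∑ S w) wⱼ≡0 T⁺-j≡T ⟩
      ∑ T w ∎
      where
      open ≤-Reasoning
      T⁺ = T ∪ ⁅ j ⁆
      j∈T⁺ : j ∈ T⁺
      j∈T⁺ = x∈p∪q⁺ (inj₂ (x∈⁅x⁆ j))
      T⁺-j≡T : T⁺ - j ≡ T
      T⁺-j≡T = x∉p⇒[p∪⁅x⁆]-x≡p (λ j∈T → x∈p─q⇒x∉q ⊤ ⁅ j ⁆ (T⊆U j∈T) (x∈⁅x⁆ j))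
      ∣T⁺∣≡1+p : ∣ T⁺ ∣ ≡ suc p
      ∣T⁺∣≡1+p = trans (x∈p⇒∣p∣≡1+∣p-x∣ j∈T⁺) (cong suc (trans (cong ∣_∣ T⁺-j≡T) ∣T∣≡p))

  complement-bound : ∀ A → ∣ ∁ A ∣ ≡ q → δ + ∣ preimage φ A ∣ ≤ n
  complement-bound A ∣∁A∣≡q = begin
    δ + ∣ preimage φ A ∣                  ≤⟨ +-monoˡ-≤ _ (heavy (∁ A) ∣∁A∣≡q) ⟩
    ∣ preimage φ (∁ A) ∣ + ∣ preimage φ A ∣ ≡⟨ +-comm _ ∣ preimage φ A ∣ ⟩
    ∣ preimage φ A ∣ + ∣ preimage φ (∁ A) ∣ ≡⟨ preimage-∁ φ A ⟩
    n ∎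
    where open ≤-Reasoning

-- Arithmetic, after substituting r = 1 + c and k = r + a

private
  3[r+a]∸3r : ∀ r a → 3 * (r + a) ∸ 3 * r ≡ 3 * a
  3[r+a]∸3r r a = trans (cong (_∸ 3 * r) (*-distribˡ-+ 3 r a)) (m+n∸m≡n (3 * r) (3 * a))

  3[1+c+a]∸2 : ∀ c a → 3 * (suc c + a) ∸ 2 ≡ 3 * c + 3 * a + 1
  3[1+c+a]∸2 c a = cong (_∸ 2) (expand c a)
    where
    expand : ∀ c a → 3 * (suc c + a) ≡ 2 + (3 * c + 3 * a + 1)
    expand = solve-∀

  xyz≡zxy : ∀ x y z → x * y * z ≡ z * x * y
  xyz≡zxy = solve-∀

  expand₁ : ∀ n a c → n * a * (3 * c + 3 * a + 1) + n * c ≡ (3 * a + 1) * n * (c + a)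
  expand₁ = solve-∀

  expand₂ : ∀ n a c → n * (3 * c + 3 * a + 1) ≡ (3 * a + 1) * n + c * (3 * n)
  expand₂ = solve-∀

missing-colour-impossible : ∀ n δ a b → let c = suc b ; D = 3 * c + 3 * a + 1 in
  (3 * a + 1) * n < δ * D → ¬ ((c + a) * δ ≤ n * a)
missing-colour-impossible n δ a b h₁ h₂ = <-irrefl refl (begin-strict
  n * a * D                 ≤⟨ m≤m+n (n * a * D) (n * c) ⟩
  n * a * D + n * c         ≡⟨ expand₁ n a c ⟩
  (3 * a + 1) * n * (c + a) <⟨ *-monoˡ-< (c + a) h₁ ⟩
  δ * D * (c + a)           ≡⟨ xyz≡zxy δ D (c + a) ⟩
  (c + a) * δ * D           ≤⟨ *-monoˡ-≤ D h₂ ⟩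
  n * a * D                 ∎)
  where
  open ≤-Reasoning
  c = suc b
  D = 3 * c + 3 * a + 1

big-classes-impossible : ∀ n δ a c W → let D = 3 * c + 3 * a + 1 in
  (3 * a + 1) * n < δ * D → c * (3 * n) ≤ W * D → ¬ (δ + W ≤ n)
big-classes-impossible n δ a c W h₁ h₂ h₃ = <-irrefl refl (begin-strict
  (3 * a + 1) * n + c * (3 * n) <⟨ +-mono-<-≤ h₁ h₂ ⟩
  δ * D + W * D                 ≡⟨ *-distribʳ-+ D δ W ⟨
  (δ + W) * D                   ≤⟨ *-monoˡ-≤ D h₃ ⟩
  n * D                         ≡⟨ expand₂ n a c ⟩
  (3 * a + 1) * n + c * (3 * n) ∎)
  where
  open ≤-Reasoning
  D = 3 * c + 3 * a + 1

missing-colour-arith : ∀ {n δ k r} → 2 ≤ r → r ≤ k →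
  (3 * k ∸ 3 * r + 1) * n < δ * (3 * k ∸ 2) → ¬ ((k ∸ 1) * δ ≤ n * (k ∸ r))
missing-colour-arith {n} {δ} {r = suc (suc b)} (s≤s (s≤s z≤n)) r≤k h₁ h₂ with m≤n⇒∃[o]m+o≡n r≤k
... | a , refl = missing-colour-impossible n δ a b
  (subst₂ (λ x y → x * n < δ * y) (cong (_+ 1) (3[r+a]∸3r (2 + b) a)) (3[1+c+a]∸2 (suc b) a) h₁)
  (subst (λ x → (suc b + a) * δ ≤ n * x) (m+n∸m≡n b a) h₂)

big-classes-arith : ∀ {n δ k r W} → 1 ≤ r → r ≤ k →
  (3 * k ∸ 3 * r + 1) * n < δ * (3 * k ∸ 2) → (r ∸ 1) * (3 * n) ≤ W * (3 * k ∸ 2) → ¬ (δ + W ≤ n)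
big-classes-arith {n} {δ} {r = suc c} {W} (s≤s z≤n) r≤k h₁ h₂ with m≤n⇒∃[o]m+o≡n r≤k
... | a , refl = big-classes-impossible n δ a c W
  (subst₂ (λ x y → x * n < δ * y) (cong (_+ 1) (3[r+a]∸3r (suc c) a)) (3[1+c+a]∸2 c a) h₁)
  (subst (λ y → c * (3 * n) ≤ W * y) (3[1+c+a]∸2 c a) h₂)

k∸[r∸1]≡k∸r+1 : ∀ {k r} → 1 ≤ r → r ≤ k → k ∸ (r ∸ 1) ≡ k ∸ r + 1
k∸[r∸1]≡k∸r+1 {k} {suc c} _ r≤k = trans (+-∸-assoc 1 r≤k) (+-comm 1 (k ∸ suc c))

r+[k∸r+1]≡1+k : ∀ {k r} → r ≤ k → r + (k ∸ r + 1) ≡ suc k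
r+[k∸r+1]≡1+k {k} {r} r≤k = trans (sym (+-assoc r (k ∸ r) 1)) (trans (cong (_+ 1) (m+[n∸m]≡n r≤k)) (+-comm k 1))

∈-bigClasses : ∀ {φ : Fin n → Fin k} {j} → j ∈ bigClasses φ → 3 * n ≤ classSize φ j * (3 * k ∸ 2)
∈-bigClasses {n} {k} {φ} {j} j∈B =
  ≤ᵇ⇒≤ (3 * n) _ (subst T (sym (trans (sym (lookup∘tabulate _ j)) ([]=⇒lookup j∈B))) tt)

module _ {r δ} (φ : Fin n → Fin k) (r≥2 : 2 ≤ r) (r≤k : r ≤ k)
         (h₁ : (3 * k ∸ 3 * r + 1) * n < δ * (3 * k ∸ 2))
         (heavy : ∀ T → ∣ T ∣ ≡ k ∸ r + 1 → δ ≤ ∣ preimage φ T ∣) where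

  surjective : ∀ j → ∃[ v ] φ v ≡ j
  surjective j with any? (λ v → φ v ≟ᶠ j)
  ... | yes found = found
  ... | no  none  = ⊥-elim (missing-colour-arith {n} {δ} {k} {r} r≥2 r≤k h₁
    (missing-colour-bound φ heavy (+-comm (k ∸ r) 1) q≤k (λ v φv≡j → none (v , φv≡j))))
    where
    q≤k : k ∸ r + 1 ≤ k
    q≤k = subst (_≤ k) (k∸[r∸1]≡k∸r+1 (≤-trans (s≤s z≤n) r≥2) r≤k) (m∸n≤m k (r ∸ 1))

  few-big-classes : ∣ bigClasses φ ∣ ≤ r ∸ 2
  few-big-classes with ∣ bigClasses φ ∣ ≤? r ∸ 2
  ... | yes few  = few
  ... | no  many with ∃-⊆-of-size (bigClasses φ) (subst (_≤ ∣ bigClasses φ ∣) (sym (+-∸-assoc 1 r≥2)) (≰⇒> many))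
  ...   | A , A⊆B , ∣A∣≡r-1 =
    ⊥-elim (big-classes-arith {n} {δ} {k} {r} r≥1 r≤k h₁ A-heavy (complement-bound φ heavy A ∣∁A∣≡q))
    where
    r≥1 : 1 ≤ r
    r≥1 = ≤-trans (s≤s z≤n) r≥2
    A-heavy : (r ∸ 1) * (3 * n) ≤ ∣ preimage φ A ∣ * (3 * k ∸ 2)
    A-heavy = subst (λ m → m * (3 * n) ≤ ∣ preimage φ A ∣ * (3 * k ∸ 2)) ∣A∣≡r-1
      (classwise-lower-bound φ A (λ j∈A → ∈-bigClasses {φ = φ} (A⊆B j∈A)))
    ∣∁A∣≡q : ∣ ∁ A ∣ ≡ k ∸ r + 1
    ∣∁A∣≡q = trans (∣∁p∣≡n∸∣p∣ A) (trans (cong (k ∸_) ∣A∣≡r-1) (k∸[r∸1]≡k∸r+1 r≥1 r≤k))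

proposition2p1 : (n k r : ℕ) → 2 ≤ r → r ≤ k → k ≤ n →
    (H : Hypergraph n r) → Colorable H k → NoIsolated H →
    (δ : ℕ) → IsMinPosCodeg H δ →
    (3 * k ∸ 3 * r + 1) * n < δ * (3 * k ∸ 2) →
    (k ∸ r + 1) * n < δ * (k + 2) →
    (φ : Fin n → Fin k) → IsHom H φ →
    ((J : Subset k) → k ∸ r + 1 ≤ ∣ J ∣ →
        ∣ J ∣ * δ ≤ ∣ preimage φ J ∣ * (k ∸ r + 1))
    × ((j : Fin k) → Σ (Fin n) λ v → φ v ≡ j)
    × ∣ bigClasses φ ∣ ≤ r ∸ 2
proposition2p1 n k r r≥2 r≤k _ H _ _ δ δ-min h₁ _ φ hom =
  preimage-averaging φ heavy , surjective φ r≥2 r≤k h₁ heavy , few-big-classes φ r≥2 r≤k h₁ heavy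
  where
  heavy : ∀ T → ∣ T ∣ ≡ k ∸ r + 1 → δ ≤ ∣ preimage φ T ∣
  heavy T ∣T∣≡q = minCodeg≤∣preimage∣ H hom T k<r+∣T∣ δ-min
    where
    k<r+∣T∣ : k < r + ∣ T ∣
    k<r+∣T∣ = subst (k <_) (sym (trans (cong (r +_) ∣T∣≡q) (r+[k∸r+1]≡1+k r≤k))) (n<1+n k)
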